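{- Let $\Gamma$ be a transitive digraph on $n$ vertices, and let $m$ be the size of the largest clique in $\Gamma$. Then $w(\Gamma) \le n(n+m)/2$. In particular, if $m \le n/2$, then $w(\Gamma) \le (3/4)n^2$.
   Context: Digraphs are finite, without loops; a digraph is transitive if whenever $(\alpha,\beta)$ and $(\beta,\gamma)$ are edges with $\alpha\ne\gamma$, $(\alpha,\gamma)$ is an edge. A clique is a subset $A$ of vertices such that for all distinct $\alpha,\beta\in A$, $(\alpha,\beta)$ is an edge. The weight $w(\Gamma)$ is the number of ordered pairs $(\alpha,\beta)$ of (not necessarily distinct) vertices such that there is a directed path (possibly of length $0$) from $\alpha$ to $\beta$. -}

module Defs where

open import Data.Nat using (ℕ)
open import Data.Fin using (Fin)
open import Data.Fin.Subset using (Subset; _∈_; ∣_∣)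
open import Data.Product using (_×_; _,_)
open import Data.List using (List; length)
open import Data.List.Relation.Unary.Unique.Propositional using (Unique)
import Data.List.Membership.Propositional as LM
open import Relation.Binary.Construct.Closure.ReflexiveTransitive using (Star)
open import Relation.Binary.PropositionalEquality using (_≡_)
open import Relation.Nullary using (¬_)

record Digraph (n : ℕ) : Set₁ where
  field
    Edge   : Fin n → Fin n → Set
    noLoop : ∀ a → ¬ Edge a a

open Digraph public

Transitive : ∀ {n} → Digraph n → Set
Transitive {n} Γ = ∀ {a b c : Fin n} → Edge Γ a b → Edge Γ b c → ¬ (a ≡ c) → Edge Γ a c

IsClique : ∀ {n} → Digraph n → Subset n → Set
IsClique {n} Γ A = ∀ {a b : Fin n} → a ∈ A → b ∈ A → ¬ (a ≡ b) → Edge Γ a b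

IsCliqueNumber : ∀ {n} → Digraph n → ℕ → Set
IsCliqueNumber {n} Γ m =
  (Data.Product.∃ λ (A : Subset n) → IsClique Γ A × ∣ A ∣ ≡ m)
  × (∀ (A : Subset n) → IsClique Γ A → ∣ A ∣ Data.Nat.≤ m)

Reach : ∀ {n} → Digraph n → Fin n → Fin n → Set
Reach Γ = Star (Edge Γ)

-- w is the weight: the number of ordered pairs (a , b) with a path from a to b,
-- i.e. the cardinality of the set of such pairs, witnessed by a duplicate-free
-- list enumerating exactly those pairs.
IsWeight : ∀ {n} → Digraph n → ℕ → Set
IsWeight {n} Γ w =
  Data.Product.∃ λ (ps : List (Fin n × Fin n)) →
    Unique ps × (∀ a b → (LM._∈_ (a , b) ps → Reach Γ a b) × (Reach Γ a b → LM._∈_ (a , b) ps))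
    × length ps ≡ w

-- For each vertex a, the vertices b joined to a by paths in both directions
-- form a clique, since by transitivity a path between distinct vertices is an
-- edge; so there are at most m of them. Adding the number of reachable pairs
-- (a , b) to the number of pairs whose reversal (b , a) is reachable, each of
-- the n² ordered pairs contributes at most 1, except mutually reachable pairs,
-- which contribute 2. Hence 2 w ≤ n² + n m.
module Submission where

open import Defs
open import Data.Nat using (ℕ; zero; suc; _+_; _*_; _≤_; z≤n)
open import Data.Nat.Properties
  using (≤-refl; ≤-trans; +-mono-≤; +-monoʳ-≤; *-monoʳ-≤; m≤m+n; m≤n+m; +-identityʳ;
         *-identityʳ; *-assoc; +-comm; *-distribˡ-+; +-0-commutativeMonoid; module ≤-Reasoning)
open import Data.Nat.Tactic.RingSolver using (solve-∀)
open import Data.Product using (_×_; _,_; proj₁; proj₂)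
open import Data.Product.Properties using (≡-dec)
open import Data.Fin using (Fin; zero; suc; _≟_)
open import Data.Fin.Subset using (Subset; ∣_∣) renaming (_∈_ to _∈ˢ_)
open import Data.Bool using (true)
open import Data.Vec using (tabulate)
open import Data.Vec.Properties using (lookup∘tabulate; []=⇒lookup)
open import Data.List using (_∷_; length)
open import Data.List.Relation.Unary.Any using (here; there)
open import Data.List.Relation.Unary.All.Properties using (All¬⇒¬Any)
open import Data.List.Relation.Unary.Unique.Propositional using (Unique; []; _∷_)
open import Data.List.Membership.Propositional using (_∈_; _∉_)
open import Relation.Binary.Construct.Closure.ReflexiveTransitive using (ε; _◅_; _◅◅_)
open import Relation.Binary.PropositionalEquality
  using (_≡_; _≢_; refl; sym; trans; cong)
open import Relation.Nullary using (Dec; yes; no; does)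
open import Relation.Nullary.Decidable using (_×-dec_)
open import Data.Empty using (⊥-elim)
open import Algebra.Properties.CommutativeMonoid.Sum +-0-commutativeMonoid
  using (sum; sum-syntax; sum-cong-≗; ∑-distrib-+; ∑-comm)

𝟙[_] : ∀ {ℓ} {P : Set ℓ} → Dec P → ℕ
𝟙[ yes _ ] = 1
𝟙[ no _ ] = 0

∑-mono-≤ : ∀ {n} {f g : Fin n → ℕ} → (∀ i → f i ≤ g i) → sum f ≤ sum g
∑-mono-≤ {zero} f≤g = z≤n
∑-mono-≤ {suc n} f≤g = +-mono-≤ (f≤g zero) (∑-mono-≤ (λ i → f≤g (suc i)))

∑-const : ∀ n c → (∑[ i < n ] c) ≡ n * c
∑-const zero c = refl
∑-const (suc n) c = cong (c +_) (∑-const n c)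

term≤∑ : ∀ {n} (f : Fin n → ℕ) (i : Fin n) → f i ≤ sum f
term≤∑ f zero = m≤m+n _ _
term≤∑ f (suc i) = ≤-trans (term≤∑ (λ j → f (suc j)) i) (m≤n+m _ (f zero))

⁅_⁆ : ∀ {p} {n} {P : Fin n → Set p} → (∀ i → Dec (P i)) → Subset n
⁅ P? ⁆ = tabulate (λ i → does (P? i))

∈⁅⁆⇒ : ∀ {p} {n} {P : Fin n → Set p} (P? : ∀ i → Dec (P i)) {i} →
  i ∈ˢ ⁅ P? ⁆ → P i
∈⁅⁆⇒ {P = P} P? {i} i∈ = from-does (P? i) (trans (sym (lookup∘tabulate _ i)) ([]=⇒lookup i∈))
  where
  from-does : (d : Dec (P i)) → does d ≡ true → P i
  from-does (yes p) _ = p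

∣⁅⁆∣≡∑𝟙 : ∀ {p} {n} {P : Fin n → Set p} (P? : ∀ i → Dec (P i)) →
  ∣ ⁅ P? ⁆ ∣ ≡ (∑[ i < n ] 𝟙[ P? i ])
∣⁅⁆∣≡∑𝟙 {n = zero} P? = refl
∣⁅⁆∣≡∑𝟙 {n = suc n} P? with P? zero
... | yes _ = cong suc (∣⁅⁆∣≡∑𝟙 (λ i → P? (suc i)))
... | no _ = ∣⁅⁆∣≡∑𝟙 (λ i → P? (suc i))

module PairCounting {n k : ℕ} where

  _≟²_ : (x y : Fin n × Fin k) → Dec (x ≡ y)
  _≟²_ = ≡-dec _≟_ _≟_

  open import Data.List.Membership.DecPropositional _≟²_ using (_∈?_) public

  𝟙∈?-∷ : ∀ {x xs} → x ∉ xs → ∀ y → 𝟙[ y ∈? x ∷ xs ] ≡ 𝟙[ y ≟² x ] + 𝟙[ y ∈? xs ]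
  𝟙∈?-∷ {x} {xs} x∉xs y with y ≟² x | y ∈? xs | y ∈? x ∷ xs
  ... | yes refl | yes y∈xs | _        = ⊥-elim (x∉xs y∈xs)
  ... | yes _    | no _     | yes _    = refl
  ... | yes y≡x  | no _     | no y∉    = ⊥-elim (y∉ (here y≡x))
  ... | no _     | yes _    | yes _    = refl
  ... | no _     | yes y∈xs | no y∉    = ⊥-elim (y∉ (there y∈xs))
  ... | no y≢x   | no _     | yes (here y≡x)    = ⊥-elim (y≢x y≡x)
  ... | no _     | no y∉xs  | yes (there y∈xs)  = ⊥-elim (y∉xs y∈xs)
  ... | no _     | no _     | no _     = refl

  length≤∑∑𝟙∈? : ∀ {xs} → Unique xs → length xs ≤ ∑[ a < n ] ∑[ b < k ] 𝟙[ (a , b) ∈? xs ]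
  length≤∑∑𝟙∈? [] = z≤n
  length≤∑∑𝟙∈? {(a₀ , b₀) ∷ xs} (x≢xs ∷ u) = begin
    1 + length xs
      ≤⟨ +-mono-≤ 1≤∑∑𝟙≟ (length≤∑∑𝟙∈? u) ⟩
    (∑[ a < n ] ∑[ b < k ] 𝟙[ (a , b) ≟² x ]) + (∑[ a < n ] ∑[ b < k ] 𝟙[ (a , b) ∈? xs ])
      ≡⟨ sym (∑-distrib-+ (λ a → ∑[ b < k ] 𝟙[ (a , b) ≟² x ]) (λ a → ∑[ b < k ] 𝟙[ (a , b) ∈? xs ])) ⟩
    ∑[ a < n ] ((∑[ b < k ] 𝟙[ (a , b) ≟² x ]) + (∑[ b < k ] 𝟙[ (a , b) ∈? xs ]))
      ≡⟨ sum-cong-≗ (λ a → sym (∑-distrib-+ (λ b → 𝟙[ (a , b) ≟² x ]) (λ b → 𝟙[ (a , b) ∈? xs ]))) ⟩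
    ∑[ a < n ] ∑[ b < k ] (𝟙[ (a , b) ≟² x ] + 𝟙[ (a , b) ∈? xs ])
      ≡⟨ sum-cong-≗ (λ a → sum-cong-≗ (λ b → sym (𝟙∈?-∷ (All¬⇒¬Any x≢xs) (a , b)))) ⟩
    ∑[ a < n ] ∑[ b < k ] 𝟙[ (a , b) ∈? x ∷ xs ] ∎
    where
    open ≤-Reasoning
    x = (a₀ , b₀)
    𝟙[x≟x] : (d : Dec (x ≡ x)) → 1 ≤ 𝟙[ d ]
    𝟙[x≟x] (yes _) = ≤-refl
    𝟙[x≟x] (no x≢x) = ⊥-elim (x≢x refl)
    1≤∑∑𝟙≟ : 1 ≤ ∑[ a < n ] ∑[ b < k ] 𝟙[ (a , b) ≟² x ]
    1≤∑∑𝟙≟ = ≤-trans (𝟙[x≟x] (x ≟² x))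
               (≤-trans (term≤∑ (λ b → 𝟙[ (a₀ , b) ≟² x ]) b₀)
                 (term≤∑ (λ a → ∑[ b < k ] 𝟙[ (a , b) ≟² x ]) a₀))

module _ {r} {n : ℕ} {R : Fin n → Fin n → Set r} (R? : ∀ a b → Dec (R a b)) where

  𝟙-both-ways : ∀ a b → 𝟙[ R? a b ] + 𝟙[ R? b a ] ≤ 1 + 𝟙[ R? a b ×-dec R? b a ]
  𝟙-both-ways a b with R? a b | R? b a
  ... | yes _ | yes _ = ≤-refl
  ... | yes _ | no _  = ≤-refl
  ... | no _  | yes _ = ≤-refl
  ... | no _  | no _  = z≤n

  2*∑∑𝟙≤n*n+∑∑𝟙-both-ways :
    2 * (∑[ a < n ] ∑[ b < n ] 𝟙[ R? a b ])
      ≤ n * n + ∑[ a < n ] ∑[ b < n ] 𝟙[ R? a b ×-dec R? b a ]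
  2*∑∑𝟙≤n*n+∑∑𝟙-both-ways = begin
    2 * S (λ a b → 𝟙[ R? a b ])
      ≡⟨ cong (S (λ a b → 𝟙[ R? a b ]) +_) (+-identityʳ _) ⟩
    S (λ a b → 𝟙[ R? a b ]) + S (λ a b → 𝟙[ R? a b ])
      ≡⟨ cong (S (λ a b → 𝟙[ R? a b ]) +_) (∑-comm (λ a b → 𝟙[ R? a b ])) ⟩
    S (λ a b → 𝟙[ R? a b ]) + S (λ a b → 𝟙[ R? b a ])
      ≡⟨ S-distrib-+ (λ a b → 𝟙[ R? a b ]) (λ a b → 𝟙[ R? b a ]) ⟨
    S (λ a b → 𝟙[ R? a b ] + 𝟙[ R? b a ])
      ≤⟨ ∑-mono-≤ (λ a → ∑-mono-≤ (𝟙-both-ways a)) ⟩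
    S (λ a b → 1 + 𝟙[ R? a b ×-dec R? b a ])
      ≡⟨ S-distrib-+ (λ _ _ → 1) (λ a b → 𝟙[ R? a b ×-dec R? b a ]) ⟩
    S (λ _ _ → 1) + S (λ a b → 𝟙[ R? a b ×-dec R? b a ])
      ≡⟨ cong (_+ S (λ a b → 𝟙[ R? a b ×-dec R? b a ])) S-1 ⟩
    n * n + S (λ a b → 𝟙[ R? a b ×-dec R? b a ]) ∎
    where
    open ≤-Reasoning
    S : (Fin n → Fin n → ℕ) → ℕ
    S f = ∑[ a < n ] ∑[ b < n ] f a b
    S-distrib-+ : ∀ f g → S (λ a b → f a b + g a b) ≡ S f + S g
    S-distrib-+ f g = trans (sum-cong-≗ {n} (λ a → ∑-distrib-+ (f a) (g a)))
                            (∑-distrib-+ (λ a → ∑[ b < n ] f a b) (λ a → ∑[ b < n ] g a b))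
    S-1 : S (λ _ _ → 1) ≡ n * n
    S-1 = begin-equality
      S (λ _ _ → 1)     ≡⟨ sum-cong-≗ {n} (λ _ → trans (∑-const n 1) (*-identityʳ n)) ⟩
      (∑[ a < n ] n)    ≡⟨ ∑-const n n ⟩
      n * n             ∎

module _ {n : ℕ} {Γ : Digraph n} (transitive : Transitive Γ) where

  Reach⇒Edge : ∀ {a b} → Reach Γ a b → a ≢ b → Edge Γ a b
  Reach⇒Edge ε a≢a = ⊥-elim (a≢a refl)
  Reach⇒Edge {b = b} (_◅_ {j = c} a→c c⇝b) a≢b with c ≟ b
  ... | yes refl = a→c
  ... | no c≢b   = transitive a→c (Reach⇒Edge c⇝b c≢b) a≢b

  mutuallyReachable-isClique : ∀ a (A : Subset n) →
    (∀ {b} → b ∈ˢ A → Reach Γ a b × Reach Γ b a) → IsClique Γ A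
  mutuallyReachable-isClique a A a⇄ b∈A c∈A b≢c =
    Reach⇒Edge (proj₂ (a⇄ b∈A) ◅◅ proj₁ (a⇄ c∈A)) b≢c

  open PairCounting {n} {n}

  2*weight≤n*[n+m] : ∀ {m} → (∀ A → IsClique Γ A → ∣ A ∣ ≤ m) →
    ∀ {ps} → Unique ps → (∀ {a b} → (a , b) ∈ ps → Reach Γ a b) →
    2 * length ps ≤ n * (n + m)
  2*weight≤n*[n+m] {m} ω≤m {ps} unique sound = begin
    2 * length ps
      ≤⟨ *-monoʳ-≤ 2 (length≤∑∑𝟙∈? unique) ⟩
    2 * (∑[ a < n ] ∑[ b < n ] 𝟙[ R? a b ])
      ≤⟨ 2*∑∑𝟙≤n*n+∑∑𝟙-both-ways R? ⟩
    n * n + ∑[ a < n ] ∑[ b < n ] 𝟙[ R? a b ×-dec R? b a ]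
      ≤⟨ +-monoʳ-≤ (n * n) (∑-mono-≤ component≤m) ⟩
    n * n + ∑[ a < n ] m
      ≡⟨ cong (n * n +_) (∑-const n m) ⟩
    n * n + n * m
      ≡⟨ *-distribˡ-+ n n m ⟨
    n * (n + m) ∎
    where
    open ≤-Reasoning
    -- Reachability need not be decidable; membership in ps decides it.
    R? : ∀ a b → Dec ((a , b) ∈ ps)
    R? a b = (a , b) ∈? ps
    component≤m : ∀ a → ∑[ b < n ] 𝟙[ R? a b ×-dec R? b a ] ≤ m
    component≤m a = begin
      ∑[ b < n ] 𝟙[ R? a b ×-dec R? b a ]  ≡⟨ ∣⁅⁆∣≡∑𝟙 (λ b → R? a b ×-dec R? b a) ⟨
      ∣ ⁅ (λ b → R? a b ×-dec R? b a) ⁆ ∣  ≤⟨ ω≤m _ (mutuallyReachable-isClique a _ reach⇄) ⟩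
      m                                   ∎
      where
      reach⇄ : ∀ {b} → b ∈ˢ ⁅ (λ b → R? a b ×-dec R? b a) ⁆ → Reach Γ a b × Reach Γ b a
      reach⇄ b∈ with ∈⁅⁆⇒ (λ b → R? a b ×-dec R? b a) b∈
      ... | ab∈ps , ba∈ps = sound ab∈ps , sound ba∈ps

4*w≤3*n*n : ∀ n m w → 2 * w ≤ n * (n + m) → 2 * m ≤ n → 4 * w ≤ 3 * (n * n)
4*w≤3*n*n n m w 2w≤ 2m≤n = begin
  4 * w                       ≡⟨ *-assoc 2 2 w ⟩
  2 * (2 * w)                 ≤⟨ *-monoʳ-≤ 2 2w≤ ⟩
  2 * (n * (n + m))           ≡⟨ expand n m ⟩
  2 * (n * n) + n * (2 * m)   ≤⟨ +-monoʳ-≤ (2 * (n * n)) (*-monoʳ-≤ n 2m≤n) ⟩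
  2 * (n * n) + n * n         ≡⟨ +-comm (2 * (n * n)) (n * n) ⟩
  3 * (n * n)                 ∎
  where
  open ≤-Reasoning
  expand : ∀ n m → 2 * (n * (n + m)) ≡ 2 * (n * n) + n * (2 * m)
  expand = solve-∀

proposition2p4 : ∀ (n : ℕ) (Γ : Digraph n) (m w : ℕ) → Transitive Γ →
    IsCliqueNumber Γ m → IsWeight Γ w →
    (2 * w ≤ n * (n + m)) × (2 * m ≤ n → 4 * w ≤ 3 * (n * n))
proposition2p4 n Γ m w transitive (_ , ω≤m) (ps , unique , spec , refl) =
  2w≤ , 4*w≤3*n*n n m (length ps) 2w≤
  where
  2w≤ : 2 * length ps ≤ n * (n + m)
  2w≤ = 2*weight≤n*[n+m] {Γ = Γ} transitive ω≤m unique (λ {a} {b} → proj₁ (spec a b))
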